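{- Let $I_{MR}$ be an instance of MIN-REP with inputs $G=(X,Y,E)$, $\mathcal{P}_X$, $\mathcal{P}_Y$, and let $I_D$ be the instance of the 1-DR-2 problem whose input graph is the graph $G'$ constructed from it as described in the context. Let $s>0$ and $\epsilon>0$. If every (feasible) solution of $I_{MR}$ has size at least $s\cdot 2^{\log^{1-\epsilon} n(G)}$, then every (feasible) solution of $I_D$ has size at least $s\cdot 2^{\log^{1-\epsilon} n(G)}+4$, where $n(G)$ is the number of vertices of $G$.
   Context: MIN-REP problem: input a bipartite graph $G=(X,Y,E)$, a partition $\mathcal{P}_X=\{X_1,\dots,X_{k_X}\}$ of $X$ into sets of size $|X|/k_X$, and a partition $\mathcal{P}_Y=\{Y_1,\dots,Y_{k_Y}\}$ of $Y$ into sets of size $|Y|/k_Y$. $X_i$ and $Y_j$ form a super edge if some vertex of $X_i$ is adjacent in $G$ to some vertex of $Y_j$. A feasible solution is a set $S\subseteq X\cup Y$ such that for every super edge $(X_i,Y_j)$ there are $x\in S\cap X_i$ and $y\in S\cap Y_j$ with $(x,y)\in E$; the goal is to minimize $|S|$. Construction of $G'$: start with $G$. For each $X_i$ add two vertices $px^1_i,px^2_i$ and edges $(x,px^1_i),(x,px^2_i)$ for every $x\in X_i$; for each $Y_j$ add two vertices $py^1_j,py^2_j$ and edges $(y,py^1_j),(y,py^2_j)$ for every $y\in Y_j$. For each super edge $(X_i,Y_j)$ add two vertices (relays) $r^1_{i,j},r^2_{i,j}$ and edges $(px^1_i,r^1_{i,j}),(r^1_{i,j},py^1_j),(px^2_i,r^2_{i,j}),(r^2_{i,j},py^2_j)$.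 Let $PX$ be the set of all $px^I_i$, $PY$ the set of all $py^I_j$, $R$ the set of relays. Add four hubs $h_{X,R},h_{Y,R},h_{PX},h_{PY}$: $h_{X,R}$ is adjacent to every vertex of $X\cup R$, $h_{Y,R}$ to every vertex of $Y\cup R$, $h_{PX}$ to every vertex of $PX$, $h_{PY}$ to every vertex of $PY$, and the hubs form the 4-cycle $(h_{PX},h_{Y,R},h_{PY},h_{X,R},h_{PX})$. Finally, for each hub $h$ add two new vertices (dummy nodes) $d_1,d_2$ and edges $(h,d_1),(h,d_2)$. 1-DR-2 problem: for vertices $u,v$ of a graph $G'$, $m_{G'}(u,v)$ is the number of internal vertices on a shortest $u$–$v$ path ($\infty$ if none); for $D\subseteq V(G')$, $m^D(u,v)=m_{G'[D\cup\{u,v\}]}(u,v)$. Vertices $u,v$ form a target couple if $m_{G'}(u,v)=1$; $D$ covers it if $m^D(u,v)\le 2$. A feasible solution is a dominating set $D$ of $G'$ covering all target couples; the goal is to minimize $|D|$. -}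

module Defs where

open import Data.Nat using (ℕ; zero; suc; _≤_)
open import Data.Fin using (Fin)
open import Data.Bool using (Bool; T)
open import Data.List using (List; allFin)
open import Data.Bool.ListAction using (any)
open import Data.Unit using (⊤)
open import Data.List.Membership.Propositional using (_∈_)
open import Data.Product using (Σ; ∃; _×_; ∃-syntax)
open import Data.Sum using (_⊎_)
open import Relation.Nullary using (¬_)
open import Relation.Binary.PropositionalEquality using (_≡_)

-- X is partitioned into kX parts X_1..X_kX, each of size sX; we index
-- the vertices of X as pairs (i , p) with i : Fin kX the part and
-- p : Fin sX the position inside the part (so every part has size
-- |X|/kX).  Same for Y.

record MinRep : Set where
  field
    kX sX kY sY : ℕ
    E : Fin kX → Fin sX → Fin kY → Fin sY → Bool

module _ (I : MinRep) where
  open MinRep I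

  superEdge : Fin kX → Fin kY → Bool
  superEdge i j = any (λ p → any (λ q → E i p j q) (allFin sY)) (allFin sX)

  SuperEdge : Fin kX → Fin kY → Set
  SuperEdge i j = T (superEdge i j)

  data VG : Set where
    vx : Fin kX → Fin sX → VG
    vy : Fin kY → Fin sY → VG

  MRFeasible : List VG → Set
  MRFeasible S = ∀ i j → SuperEdge i j →
    ∃[ p ] ∃[ q ] (vx i p ∈ S × vy j q ∈ S × T (E i p j q))

data Hub : Set where
  hXR hYR hPX hPY : Hub

module _ (I : MinRep) where
  open MinRep I

  data V : Set where
    x     : Fin kX → Fin sX → V
    y     : Fin kY → Fin sY → V
    px    : Fin 2 → Fin kX → V
    py    : Fin 2 → Fin kY → V
    relay : Fin 2 → (i : Fin kX) (j : Fin kY) → SuperEdge I i j → V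
    hub   : Hub → V
    dummy : Hub → Fin 2 → V

  -- edges of G' (each undirected edge listed once, in one orientation)
  data Edge : V → V → Set where
    e-G    : ∀ {i p j q} → T (E i p j q) → Edge (x i p) (y j q)
    e-xpx  : ∀ {i p} c → Edge (x i p) (px c i)
    e-ypy  : ∀ {j q} c → Edge (y j q) (py c j)
    e-pxr  : ∀ {c i j} (s : SuperEdge I i j) → Edge (px c i) (relay c i j s)
    e-rpy  : ∀ {c i j} (s : SuperEdge I i j) → Edge (relay c i j s) (py c j)
    e-hXR-x : ∀ {i p} → Edge (hub hXR) (x i p)
    e-hXR-r : ∀ {c i j} (s : SuperEdge I i j) → Edge (hub hXR) (relay c i j s)
    e-hYR-y : ∀ {j q} → Edge (hub hYR) (y j q)
    e-hYR-r : ∀ {c i j} (s : SuperEdge I i j) → Edge (hub hYR) (relay c i j s)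
    e-hPX  : ∀ {c i} → Edge (hub hPX) (px c i)
    e-hPY  : ∀ {c j} → Edge (hub hPY) (py c j)
    e-c1   : Edge (hub hPX) (hub hYR)
    e-c2   : Edge (hub hYR) (hub hPY)
    e-c3   : Edge (hub hPY) (hub hXR)
    e-c4   : Edge (hub hXR) (hub hPX)
    e-d    : ∀ {h} c → Edge (hub h) (dummy h c)

  Adj : V → V → Set
  Adj u v = Edge u v ⊎ Edge v u

  -- Walk S u v n : a walk u → v with n edges, all of whose vertices
  -- (after u) lie in S; i.e. a walk in the induced subgraph G'[S] when u ∈ S.
  data Walk (S : V → Set) : V → V → ℕ → Set where
    nil  : ∀ {u} → Walk S u u 0
    cons : ∀ {u w v n} → Adj u w → S w → Walk S w v n → Walk S u v (suc n)

  -- m_{G'[S]}(u,v) ≤ k  (number of internal vertices of a shortest path ≤ k),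
  -- i.e. there is a u–v walk in G'[S] with at most k+1 edges.
  mLe : (S : V → Set) → V → V → ℕ → Set
  mLe S u v k = ∃[ ℓ ] (ℓ ≤ suc k × Walk S u v ℓ)

  Everything : V → Set
  Everything _ = ⊤

  InDuv : List V → V → V → V → Set
  InDuv D u v w = w ∈ D ⊎ w ≡ u ⊎ w ≡ v

  TargetCouple : V → V → Set
  TargetCouple u v = mLe Everything u v 1 × ¬ mLe Everything u v 0

  Covers : List V → V → V → Set
  Covers D u v = mLe (InDuv D u v) u v 2

  Dominating : List V → Set
  Dominating D = ∀ v → v ∈ D ⊎ ∃[ u ] (u ∈ D × Adj v u)

  DRFeasible : List V → Set
  DRFeasible D = Dominating D × (∀ u v → TargetCouple u v → Covers D u v)

module Submission where

-- Charge every vertex of D to at most one "token", a vertex of G or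
-- a hub: vertices of G to themselves, hubs to themselves, and the relay
-- r^1_{i,j} (resp. r^2_{i,j}) to the X-end (resp. Y-end) of one fixed edge
-- of G between X_i and Y_j.  Then
--   * all four hubs are in D: a dummy couple (d_1, d_2) is a target couple
--     and every short d_1–d_2 path runs through the hub;
--   * the G-tokens of D form a feasible MIN-REP solution S: for a super
--     edge (X_i, Y_j) both couples (px^c_i, py^c_j) are target couples, and
--     a path of length ≤ 3 between them uses either an X_i–Y_j edge of G
--     or the relay r^c_{i,j}; if D contains neither such edge, it contains
--     both relays, whose charges are the ends of the fixed X_i–Y_j edge.
-- Counting tokens with one principle (a duplicate-free list contained in
-- another is not longer) gives |S| + 4 ≤ |tokens of D| ≤ |D|.

open import Defs
open import Data.Nat using (ℕ; _≤_; _<_; _+_; suc; s≤s; z≤n)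
open import Data.Nat.Properties using (+-monoˡ-≤; module ≤-Reasoning)
open import Data.List using (List; []; _∷_; _++_; length; map; mapMaybe; deduplicate; allFin)
open import Data.List.Properties using (length-mapMaybe; length-removeAt′; length-++; length-map)
open import Data.List.Relation.Unary.Any as Any using (here; there; _─_; satisfied)
open import Data.List.Relation.Unary.Any.Properties using (any⁻; map⁺; mapMaybe⁺)
open import Data.List.Relation.Unary.All as All using ([]; _∷_)
open import Data.List.Relation.Unary.AllPairs using ([]; _∷_)
open import Data.List.Relation.Unary.Unique.Propositional using (Unique)
import Data.List.Relation.Unary.Unique.Propositional.Properties as Unique
open import Data.List.Relation.Unary.Unique.DecPropositional.Properties using (deduplicate-!)
open import Data.List.Relation.Binary.Subset.Propositional using (_⊆_)
open import Data.List.Relation.Binary.Disjoint.Propositional using (Disjoint)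
open import Data.List.Membership.Propositional using (_∈_)
open import Data.List.Membership.Propositional.Properties using (∈-map⁻; ∈-++⁻; ∈-deduplicate⁺; ∈-deduplicate⁻)
open import Data.Maybe using (Maybe; just; nothing)
import Data.Maybe.Relation.Unary.Any as MaybeAny
open import Data.Fin using (Fin; zero; suc; _≟_)
open import Data.Bool using (T)
open import Data.Bool.Properties using (T-irrelevant)
open import Data.Product using (_×_; _,_; proj₁; proj₂; ∃-syntax)
open import Data.Sum using (_⊎_; inj₁; inj₂; [_,_]′)
open import Data.Sum.Properties using (inj₁-injective; inj₂-injective)
open import Data.Empty using (⊥-elim)
open import Data.Unit using (tt)
open import Relation.Nullary using (¬_; _×-dec_)
open import Relation.Nullary.Decidable using (map′; no)
open import Relation.Binary.Definitions using (DecidableEquality)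
open import Relation.Binary.PropositionalEquality using (_≡_; _≢_; refl; sym; trans; subst; cong₂)

module _ {A : Set} where

  ∈-─ : ∀ {a b} {ys : List A} (a∈ys : a ∈ ys) → b ∈ ys → a ≢ b → b ∈ (ys ─ a∈ys)
  ∈-─ (here refl) (here refl) a≢b = ⊥-elim (a≢b refl)
  ∈-─ (here _)    (there b∈ys) _  = b∈ys
  ∈-─ (there _)   (here b≡y) _    = here b≡y
  ∈-─ (there a∈ys) (there b∈ys) a≢b = there (∈-─ a∈ys b∈ys a≢b)

  unique-⊆⇒length≤ : ∀ {xs ys : List A} → Unique xs → xs ⊆ ys → length xs ≤ length ys
  unique-⊆⇒length≤ {[]}     _              _      = z≤n
  unique-⊆⇒length≤ {a ∷ xs} {ys} (a∉xs ∷ xs!) xs⊆ys =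
    subst (suc (length xs) ≤_) (sym (length-removeAt′ ys (Any.index a∈ys)))
      (s≤s (unique-⊆⇒length≤ xs! (λ b∈xs → ∈-─ a∈ys (xs⊆ys (there b∈xs)) (All.lookup a∉xs b∈xs))))
    where
    a∈ys : a ∈ ys
    a∈ys = xs⊆ys (here refl)

module _ {A B : Set} where

  ∈-mapMaybe⁺ : ∀ (f : A → Maybe B) {xs a b} → a ∈ xs → f a ≡ just b → b ∈ mapMaybe f xs
  ∈-mapMaybe⁺ f a∈xs fa≡b = mapMaybe⁺ f _ (map⁺ (Any.map hit a∈xs))
    where
    hit : ∀ {a'} → _ ≡ a' → MaybeAny.Any (_ ≡_) (f a')
    hit refl = subst (MaybeAny.Any (_ ≡_)) (sym fa≡b) (MaybeAny.just refl)

  lefts : List (A ⊎ B) → List A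
  lefts []           = []
  lefts (inj₁ a ∷ L) = a ∷ lefts L
  lefts (inj₂ _ ∷ L) = lefts L

  ∈-lefts⁺ : ∀ {a L} → inj₁ a ∈ L → a ∈ lefts L
  ∈-lefts⁺ {L = inj₁ _ ∷ _} (here refl) = here refl
  ∈-lefts⁺ {L = inj₁ _ ∷ _} (there p)   = there (∈-lefts⁺ p)
  ∈-lefts⁺ {L = inj₂ _ ∷ _} (there p)   = ∈-lefts⁺ p

  ∈-lefts⁻ : ∀ {a} L → a ∈ lefts L → inj₁ a ∈ L
  ∈-lefts⁻ (inj₁ _ ∷ L) (here refl) = here refl
  ∈-lefts⁻ (inj₁ _ ∷ L) (there p)   = there (∈-lefts⁻ L p)
  ∈-lefts⁻ (inj₂ _ ∷ L) p           = there (∈-lefts⁻ L p)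

  length-tagged : ∀ (xs : List A) (ys : List B) → length (map inj₁ xs ++ map inj₂ ys) ≡ length xs + length ys
  length-tagged xs ys = trans (length-++ (map inj₁ xs)) (cong₂ _+_ (length-map inj₁ xs) (length-map inj₂ ys))

  unique-tagged : ∀ {xs : List A} {ys : List B} → Unique xs → Unique ys → Unique (map inj₁ xs ++ map inj₂ ys)
  unique-tagged {xs} {ys} xs! ys! =
    Unique.++⁺ (Unique.map⁺ inj₁-injective xs!) (Unique.map⁺ inj₂-injective ys!) disjoint
    where
    disjoint : Disjoint (map inj₁ xs) (map inj₂ ys)
    disjoint (p , q) with ∈-map⁻ inj₁ p | ∈-map⁻ inj₂ q
    ... | _ , _ , refl | _ , _ , ()

allHubs : List Hub
allHubs = hXR ∷ hYR ∷ hPX ∷ hPY ∷ []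

allHubs-unique : Unique allHubs
allHubs-unique = ((λ ()) ∷ (λ ()) ∷ (λ ()) ∷ []) ∷ ((λ ()) ∷ (λ ()) ∷ []) ∷ ((λ ()) ∷ []) ∷ [] ∷ []

module Reduction (I : MinRep) where
  open MinRep I

  superEdgeWitness : ∀ {i j} → SuperEdge I i j → ∃[ p ] ∃[ q ] T (E i p j q)
  superEdgeWitness s =
    let (p , t) = satisfied (any⁻ _ (allFin sX) s)
        (q , e) = satisfied (any⁻ _ (allFin sY) t)
    in p , q , e

  distanceTwo : ∀ {u w v} → Adj I u w → Adj I w v → ¬ Adj I u v → u ≢ v → TargetCouple I u v
  distanceTwo uw wv u≁v u≢v = (2 , s≤s (s≤s z≤n) , cons uw tt (cons wv tt nil)) , tooClose
    where
    tooClose : ¬ mLe I (Everything I) _ _ 0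
    tooClose (0 , _ , nil)                  = u≢v refl
    tooClose (1 , _ , cons uv _ nil)        = u≁v uv
    tooClose (suc (suc _) , s≤s () , _)

  ∈-D : ∀ {D u v w} → InDuv I D u v w → w ≢ u → w ≢ v → w ∈ D
  ∈-D (inj₁ w∈D)        _   _   = w∈D
  ∈-D (inj₂ (inj₁ w≡u)) w≢u _   = ⊥-elim (w≢u w≡u)
  ∈-D (inj₂ (inj₂ w≡v)) _   w≢v = ⊥-elim (w≢v w≡v)

  -- The covering half of 1-DR-2 feasibility.
  CoversAll : List (V I) → Set
  CoversAll D = ∀ u v → TargetCouple I u v → Covers I D u v

  dummyCouple : ∀ h → TargetCouple I (dummy h zero) (dummy h (suc zero))
  dummyCouple h = distanceTwo (inj₂ (e-d zero)) (inj₁ (e-d (suc zero))) (λ { (inj₁ ()) ; (inj₂ ()) }) (λ ())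

  -- Hence every solution contains every hub: a walk leaving a dummy first enters its hub.
  hub∈D : ∀ {D} → CoversAll D → ∀ h → hub h ∈ D
  hub∈D covers h with covers _ _ (dummyCouple h)
  ... | _ , _ , cons (inj₂ (e-d _)) h∈ _ = ∈-D h∈ (λ ()) (λ ())

  data PXNeighbour (c : Fin 2) (i : Fin kX) : V I → Set where
    inPart   : ∀ p → PXNeighbour c i (x i p)
    viaRelay : ∀ j s → PXNeighbour c i (relay c i j s)
    viaHub   : PXNeighbour c i (hub hPX)

  data PYNeighbour (c : Fin 2) (j : Fin kY) : V I → Set where
    inPart   : ∀ q → PYNeighbour c j (y j q)
    viaRelay : ∀ i s → PYNeighbour c j (relay c i j s)
    viaHub   : PYNeighbour c j (hub hPY)

  pxNeighbour : ∀ {c i w} → Adj I (px c i) w → PXNeighbour c i w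
  pxNeighbour (inj₁ (e-pxr s)) = viaRelay _ s
  pxNeighbour (inj₂ (e-xpx _)) = inPart _
  pxNeighbour (inj₂ e-hPX)     = viaHub

  pyNeighbour : ∀ {c j w} → Adj I w (py c j) → PYNeighbour c j w
  pyNeighbour (inj₁ (e-ypy _)) = inPart _
  pyNeighbour (inj₁ (e-rpy s)) = viaRelay _ s
  pyNeighbour (inj₁ e-hPY)     = viaHub

  EdgeIn : (V I → Set) → Fin kX → Fin kY → Set
  EdgeIn P i j = ∃[ p ] ∃[ q ] (P (x i p) × P (y j q) × T (E i p j q))

  commonNeighbour : ∀ {c i j w} → PXNeighbour c i w → PYNeighbour c j w → ∃[ s ] w ≡ relay c i j s
  commonNeighbour (viaRelay _ s) (viaRelay _ _) = s , refl
  commonNeighbour (inPart _)     ()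
  commonNeighbour viaHub         ()

  bridge : ∀ {P c i j w w'} → PXNeighbour c i w → Adj I w w' → PYNeighbour c j w' →
           P w → P w' → EdgeIn P i j
  bridge (inPart p)     (inj₁ (e-G e))      (inPart q) Pw Pw' = p , q , Pw , Pw' , e
  bridge (inPart _)     (inj₁ (e-xpx _))    ()
  bridge (inPart _)     (inj₂ e-hXR-x)      ()
  bridge (viaRelay _ _) (inj₁ (e-rpy _))    ()
  bridge (viaRelay _ _) (inj₂ (e-pxr _))    ()
  bridge (viaRelay _ _) (inj₂ (e-hXR-r _))  ()
  bridge (viaRelay _ _) (inj₂ (e-hYR-r _))  ()
  bridge viaHub         (inj₁ e-hPX)        ()
  bridge viaHub         (inj₁ e-c1)         ()
  bridge viaHub         (inj₁ (e-d _))      ()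
  bridge viaHub         (inj₂ e-c4)         ()

  shortWalk : ∀ {P c i j ℓ} → ℓ ≤ 3 → Walk I P (px c i) (py c j) ℓ →
              EdgeIn P i j ⊎ ∃[ s ] P (relay c i j s)
  shortWalk _ (cons a _ nil) with pxNeighbour a
  ... | ()
  shortWalk _ (cons a Pw (cons b _ nil)) with commonNeighbour (pxNeighbour a) (pyNeighbour b)
  ... | s , refl = inj₂ (s , Pw)
  shortWalk _ (cons a Pw (cons b Pw' (cons c _ nil))) =
    inj₁ (bridge (pxNeighbour a) b (pyNeighbour c) Pw Pw')
  shortWalk (s≤s (s≤s (s≤s ()))) (cons _ _ (cons _ _ (cons _ _ (cons _ _ _))))

  superEdgeCouple : ∀ c {i j} → SuperEdge I i j → TargetCouple I (px c i) (py c j)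
  superEdgeCouple c s = distanceTwo (inj₁ (e-pxr s)) (inj₁ (e-rpy s)) (λ { (inj₁ ()) ; (inj₂ ()) }) (λ ())

  superEdgeCovered : ∀ {D} → CoversAll D → ∀ c {i j} (s : SuperEdge I i j) →
                     EdgeIn (_∈ D) i j ⊎ relay c i j s ∈ D
  superEdgeCovered covers c s with covers _ _ (superEdgeCouple c s)
  ... | _ , ℓ≤3 , walk with shortWalk ℓ≤3 walk
  ... | inj₁ (p , q , xp , yq , e) = inj₁ (p , q , ∈-D xp (λ ()) (λ ()) , ∈-D yq (λ ()) (λ ()) , e)
  ... | inj₂ (s' , r) = inj₂ (subst (λ s → relay c _ _ s ∈ _) (T-irrelevant s' s) (∈-D r (λ ()) (λ ())))

  charge : V I → Maybe (VG I ⊎ Hub)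
  charge (x i p)                    = just (inj₁ (vx i p))
  charge (y j q)                    = just (inj₁ (vy j q))
  charge (relay zero i j s)         = just (inj₁ (vx i (proj₁ (superEdgeWitness s))))
  charge (relay (suc zero) i j s)   = just (inj₁ (vy j (proj₁ (proj₂ (superEdgeWitness s)))))
  charge (hub h)                    = just (inj₂ h)
  charge (px _ _)                   = nothing
  charge (py _ _)                   = nothing
  charge (dummy _ _)                = nothing

  tokens : List (V I) → List (VG I ⊎ Hub)
  tokens D = mapMaybe charge D

  _≟G_ : DecidableEquality (VG I)
  vx i p ≟G vx i' p' = map′ (λ { (refl , refl) → refl }) (λ { refl → refl , refl }) ((i ≟ i') ×-dec (p ≟ p'))
  vy j q ≟G vy j' q' = map′ (λ { (refl , refl) → refl }) (λ { refl → refl , refl }) ((j ≟ j') ×-dec (q ≟ q'))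
  vx _ _ ≟G vy _ _   = no λ ()
  vy _ _ ≟G vx _ _   = no λ ()

  extract : List (V I) → List (VG I)
  extract D = deduplicate _≟G_ (lefts (tokens D))

  charged∈extract : ∀ {D v a} → v ∈ D → charge v ≡ just (inj₁ a) → a ∈ extract D
  charged∈extract v∈D eq = ∈-deduplicate⁺ _≟G_ (∈-lefts⁺ (∈-mapMaybe⁺ charge v∈D eq))

  edgeExtracted : ∀ {D i j} → EdgeIn (_∈ D) i j →
                  ∃[ p ] ∃[ q ] (vx i p ∈ extract D × vy j q ∈ extract D × T (E i p j q))
  edgeExtracted (p , q , xp , yq , e) = p , q , charged∈extract xp refl , charged∈extract yq refl , e

  -- The extracted solution is feasible; if D contains both relays of a
  -- super edge, their charges are the ends of its fixed witnessing edge.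
  extract-feasible : ∀ {D} → CoversAll D → MRFeasible I (extract D)
  extract-feasible covers i j s with superEdgeCovered covers zero s | superEdgeCovered covers (suc zero) s
  ... | inj₁ edge | _         = edgeExtracted edge
  ... | inj₂ _    | inj₁ edge = edgeExtracted edge
  ... | inj₂ r⁰   | inj₂ r¹   =
    let (p , q , e) = superEdgeWitness s
    in p , q , charged∈extract r⁰ refl , charged∈extract r¹ refl , e

  tagged⊆tokens : ∀ {D} → CoversAll D → map inj₁ (extract D) ++ map inj₂ allHubs ⊆ tokens D
  tagged⊆tokens {D} covers {z} z∈ = [ fromExtract , fromHubs ]′ (∈-++⁻ (map inj₁ (extract D)) z∈)
    where
    fromExtract : z ∈ map inj₁ (extract D) → z ∈ tokens D
    fromExtract z∈S with ∈-map⁻ inj₁ z∈S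
    ... | a , a∈S , refl = ∈-lefts⁻ (tokens D) (∈-deduplicate⁻ _≟G_ (lefts (tokens D)) a∈S)

    fromHubs : z ∈ map inj₂ allHubs → z ∈ tokens D
    fromHubs z∈H with ∈-map⁻ inj₂ z∈H
    ... | h , _ , refl = ∈-mapMaybe⁺ charge (hub∈D covers h) refl

lemma9 : (I : MinRep) (t : ℕ) → 0 < t →
    (∀ (S : List (VG I)) → Unique S → MRFeasible I S → t ≤ length S) →
    ∀ (D : List (V I)) → Unique D → DRFeasible I D → t + 4 ≤ length D
lemma9 I t _ optimal D _ (_ , covers) = begin
  t + 4                                    ≤⟨ +-monoˡ-≤ 4 (optimal S S-unique (extract-feasible covers)) ⟩
  length S + 4                             ≡⟨ length-tagged S allHubs ⟨
  length (map inj₁ S ++ map inj₂ allHubs)  ≤⟨ unique-⊆⇒length≤ (unique-tagged S-unique allHubs-unique) (tagged⊆tokens covers) ⟩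
  length (tokens D)                        ≤⟨ length-mapMaybe charge D ⟩
  length D                                 ∎
  where
  open Reduction I
  open ≤-Reasoning
  S : List (VG I)
  S = extract D
  S-unique : Unique S
  S-unique = deduplicate-! _≟G_ (lefts (tokens D))
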